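{- Let $\mathcal D$ be a finite derivation (possibly with open leaves) built only from logical rules of $\mathbf{G3PDL}^{\infty}$ whose conclusion is an acyclic sequent. Then every sequent appearing in $\mathcal D$ is acyclic.
   Context: PDL: formulas $\varphi ::= \bot \mid p \mid \varphi\wedge\psi \mid \varphi\vee\psi \mid \varphi\rightarrow\psi \mid [\alpha]\varphi$, programs $\alpha ::= a \mid \alpha;\beta \mid \alpha\cup\beta \mid \varphi? \mid \alpha^{*}$. Labelled sequents $\Gamma\Rightarrow\Delta$ are pairs of finite sets of relational atoms $x\xrightarrow{a}y$ ($a$ atomic) and labelled formulas $x:\varphi$; "$A,\Gamma$" is $\{A\}\cup\Gamma$. The logical rules (premises / conclusion) are: ($\wedge$L) $x:\varphi,x:\psi,\Gamma\Rightarrow\Delta$ / $x:\varphi\wedge\psi,\Gamma\Rightarrow\Delta$; ($\wedge$R) $\Gamma\Rightarrow\Delta,x:\varphi$ and $\Gamma\Rightarrow\Delta,x:\psi$ / $\Gamma\Rightarrow\Delta,x:\varphi\wedge\psi$; ($\vee$L) $x:\varphi,\Gamma\Rightarrow\Delta$ and $x:\psi,\Gamma\Rightarrow\Delta$ / $x:\varphi\vee\psi,\Gamma\Rightarrow\Delta$; ($\vee$R) $\Gamma\Rightarrow\Delta,x:\varphi,x:\psi$ / $\Gamma\Rightarrow\Delta,x:\varphi\vee\psi$; ($\rightarrow$L) $\Gamma\Rightarrow\Delta,x:\varphi$ and $x:\psi,\Gamma\Rightarrow\Delta$ / $x:\varphi\rightarrow\psi,\Gamma\Rightarrow\Delta$;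 ($\rightarrow$R) $x:\varphi,\Gamma\Rightarrow\Delta,x:\psi$ / $\Gamma\Rightarrow\Delta,x:\varphi\rightarrow\psi$; ($\Box$L) $y:\varphi,\Gamma\Rightarrow\Delta$ / $x:[a]\varphi,x\xrightarrow{a}y,\Gamma\Rightarrow\Delta$; ($\Box$R) $x\xrightarrow{a}y,\Gamma\Rightarrow\Delta,y:\varphi$ / $\Gamma\Rightarrow\Delta,x:[a]\varphi$ where $y$ does not occur in the conclusion; (;L) $x:[\alpha][\beta]\varphi,\Gamma\Rightarrow\Delta$ / $x:[\alpha;\beta]\varphi,\Gamma\Rightarrow\Delta$; (;R) $\Gamma\Rightarrow\Delta,x:[\alpha][\beta]\varphi$ / $\Gamma\Rightarrow\Delta,x:[\alpha;\beta]\varphi$; ($\cup$L) $x:[\alpha]\varphi,x:[\beta]\varphi,\Gamma\Rightarrow\Delta$ / $x:[\alpha\cup\beta]\varphi,\Gamma\Rightarrow\Delta$; ($\cup$R) $\Gamma\Rightarrow\Delta,x:[\alpha]\varphi$ and $\Gamma\Rightarrow\Delta,x:[\beta]\varphi$ / $\Gamma\Rightarrow\Delta,x:[\alpha\cup\beta]\varphi$; (?L) $\Gamma\Rightarrow\Delta,x:\varphi$ and $x:\psi,\Gamma\Rightarrow\Delta$ / $x:[\varphi?]\psi,\Gamma\Rightarrow\Delta$; (?R) $x:\varphi,\Gamma\Rightarrow\Delta,x:\psi$ / $\Gamma\Rightarrow\Delta,x:[\varphi?]\psi$; ($*$L) $x:\varphi,x:[\alpha][\alpha^*]\varphi,\Gamma\Rightarrow\Delta$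 / $x:[\alpha^*]\varphi,\Gamma\Rightarrow\Delta$; ($*$R) $\Gamma\Rightarrow\Delta,x:\varphi$ and $\Gamma\Rightarrow\Delta,x:[\alpha][\alpha^*]\varphi$ / $\Gamma\Rightarrow\Delta,x:[\alpha^*]\varphi$. A sequent $\Gamma\Rightarrow\Delta$ is cyclic if there are a label $x$ occurring in $\Gamma$, labels $z_1,\ldots,z_n$ with $n\ge2$, $z_1=z_n=x$, and atomic programs $a_1,\ldots,a_{n-1}$ with $z_i\xrightarrow{a_i}z_{i+1}\in\Gamma$ for each $i<n$ (i.e. $x$ reaches itself by at least one relational atom in $\Gamma$); otherwise it is acyclic. -}

module Defs where

open import Data.Nat using (ℕ)
open import Data.List using (List; []; _∷_)
open import Data.List.Membership.Propositional using (_∈_)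
open import Data.List.Relation.Binary.BagAndSetEquality using (_∼[_]_; set)
open import Data.Product using (Σ; ∃; ∃-syntax; _×_; _,_)
open import Data.Sum using (_⊎_)
open import Relation.Nullary using (¬_)
open import Relation.Binary.PropositionalEquality using (_≡_)
open import Relation.Binary.Construct.Closure.Transitive using (TransClosure)

Label : Set
Label = ℕ

Atom : Set
Atom = ℕ

PVar : Set
PVar = ℕ

data Fm : Set
data Prog : Set

data Fm where
  ⊥'   : Fm
  var  : PVar → Fm
  _∧'_ : Fm → Fm → Fm
  _∨'_ : Fm → Fm → Fm
  _⇒'_ : Fm → Fm → Fm
  [_]_ : Prog → Fm → Fm

data Prog where
  atom : Atom → Prog
  _⨾_  : Prog → Prog → Prog
  _∪'_ : Prog → Prog → Prog
  _??  : Fm → Prog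
  _⋆   : Prog → Prog

-- Sequent elements: relational atoms x -a-> y and labelled formulas x : φ
data Elem : Set where
  rel : Label → Atom → Label → Elem
  lab : Label → Fm → Elem

-- Finite sets are represented by lists, compared up to set equality.
record Sequent : Set where
  constructor _⊢_
  field
    ante : List Elem
    succ : List Elem
open Sequent public

infix 3 _⊢_

_≅_ : Sequent → Sequent → Set
S ≅ T = (ante S ∼[ set ] ante T) × (succ S ∼[ set ] succ T)

LabelIn : Label → Elem → Set
LabelIn z (rel x a y) = (z ≡ x) ⊎ (z ≡ y)
LabelIn z (lab x φ)   = z ≡ x

OccursIn : Label → List Elem → Set
OccursIn z Γ = ∃[ e ] (e ∈ Γ × LabelIn z e)

OccursInSeq : Label → Sequent → Set
OccursInSeq z S = OccursIn z (ante S) ⊎ OccursIn z (succ S)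

Step : List Elem → Label → Label → Set
Step Γ x y = ∃[ a ] (rel x a y ∈ Γ)

Cyclic : Sequent → Set
Cyclic S = ∃[ x ] (OccursIn x (ante S) × TransClosure (Step (ante S)) x x)

Acyclic : Sequent → Set
Acyclic S = ¬ Cyclic S

-- One-premise logical rules: Rule1 premise conclusion
data Rule1 : Sequent → Sequent → Set where
  ∧L  : ∀ {Γ Δ x φ ψ} →
        Rule1 (lab x φ ∷ lab x ψ ∷ Γ ⊢ Δ) (lab x (φ ∧' ψ) ∷ Γ ⊢ Δ)
  ∨R  : ∀ {Γ Δ x φ ψ} →
        Rule1 (Γ ⊢ lab x φ ∷ lab x ψ ∷ Δ) (Γ ⊢ lab x (φ ∨' ψ) ∷ Δ)
  →R  : ∀ {Γ Δ x φ ψ} →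
        Rule1 (lab x φ ∷ Γ ⊢ lab x ψ ∷ Δ) (Γ ⊢ lab x (φ ⇒' ψ) ∷ Δ)
  □L  : ∀ {Γ Δ x y a φ} →
        Rule1 (lab y φ ∷ Γ ⊢ Δ) (lab x ([ atom a ] φ) ∷ rel x a y ∷ Γ ⊢ Δ)
  □R  : ∀ {Γ Δ x y a φ} → ¬ OccursInSeq y (Γ ⊢ lab x ([ atom a ] φ) ∷ Δ) →
        Rule1 (rel x a y ∷ Γ ⊢ lab y φ ∷ Δ) (Γ ⊢ lab x ([ atom a ] φ) ∷ Δ)
  ⨾L  : ∀ {Γ Δ x α β φ} →
        Rule1 (lab x ([ α ] ([ β ] φ)) ∷ Γ ⊢ Δ) (lab x ([ α ⨾ β ] φ) ∷ Γ ⊢ Δ)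
  ⨾R  : ∀ {Γ Δ x α β φ} →
        Rule1 (Γ ⊢ lab x ([ α ] ([ β ] φ)) ∷ Δ) (Γ ⊢ lab x ([ α ⨾ β ] φ) ∷ Δ)
  ∪L  : ∀ {Γ Δ x α β φ} →
        Rule1 (lab x ([ α ] φ) ∷ lab x ([ β ] φ) ∷ Γ ⊢ Δ) (lab x ([ α ∪' β ] φ) ∷ Γ ⊢ Δ)
  ?R  : ∀ {Γ Δ x φ ψ} →
        Rule1 (lab x φ ∷ Γ ⊢ lab x ψ ∷ Δ) (Γ ⊢ lab x ([ φ ?? ] ψ) ∷ Δ)
  *L  : ∀ {Γ Δ x α φ} →
        Rule1 (lab x φ ∷ lab x ([ α ] ([ α ⋆ ] φ)) ∷ Γ ⊢ Δ) (lab x ([ α ⋆ ] φ) ∷ Γ ⊢ Δ)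

-- Two-premise logical rules: Rule2 premise₁ premise₂ conclusion
data Rule2 : Sequent → Sequent → Sequent → Set where
  ∧R  : ∀ {Γ Δ x φ ψ} →
        Rule2 (Γ ⊢ lab x φ ∷ Δ) (Γ ⊢ lab x ψ ∷ Δ) (Γ ⊢ lab x (φ ∧' ψ) ∷ Δ)
  ∨L  : ∀ {Γ Δ x φ ψ} →
        Rule2 (lab x φ ∷ Γ ⊢ Δ) (lab x ψ ∷ Γ ⊢ Δ) (lab x (φ ∨' ψ) ∷ Γ ⊢ Δ)
  →L  : ∀ {Γ Δ x φ ψ} →
        Rule2 (Γ ⊢ lab x φ ∷ Δ) (lab x ψ ∷ Γ ⊢ Δ) (lab x (φ ⇒' ψ) ∷ Γ ⊢ Δ)
  ∪R  : ∀ {Γ Δ x α β φ} →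
        Rule2 (Γ ⊢ lab x ([ α ] φ) ∷ Δ) (Γ ⊢ lab x ([ β ] φ) ∷ Δ) (Γ ⊢ lab x ([ α ∪' β ] φ) ∷ Δ)
  ?L  : ∀ {Γ Δ x φ ψ} →
        Rule2 (Γ ⊢ lab x φ ∷ Δ) (lab x ψ ∷ Γ ⊢ Δ) (lab x ([ φ ?? ] ψ) ∷ Γ ⊢ Δ)
  *R  : ∀ {Γ Δ x α φ} →
        Rule2 (Γ ⊢ lab x φ ∷ Δ) (Γ ⊢ lab x ([ α ] ([ α ⋆ ] φ)) ∷ Δ) (Γ ⊢ lab x ([ α ⋆ ] φ) ∷ Δ)

-- Finite derivations built only from logical rules, possibly with open leaves.
-- A node's sequent is any list representation set-equal to the rule's conclusion.
data Deriv : Sequent → Set where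
  open-leaf : ∀ S → Deriv S
  node1 : ∀ {P C S} → Rule1 P C → C ≅ S → Deriv P → Deriv S
  node2 : ∀ {P Q C S} → Rule2 P Q C → C ≅ S → Deriv P → Deriv Q → Deriv S

data AppearsIn : ∀ {S} → Sequent → Deriv S → Set where
  root  : ∀ {S} (D : Deriv S) → AppearsIn S D
  in1   : ∀ {P C S T} {r : Rule1 P C} {e : C ≅ S} {D : Deriv P} →
          AppearsIn T D → AppearsIn T (node1 r e D)
  in2ˡ  : ∀ {P Q C S T} {r : Rule2 P Q C} {e : C ≅ S} {D : Deriv P} {E : Deriv Q} →
          AppearsIn T D → AppearsIn T (node2 r e D E)
  in2ʳ  : ∀ {P Q C S T} {r : Rule2 P Q C} {e : C ≅ S} {D : Deriv P} {E : Deriv Q} →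
          AppearsIn T E → AppearsIn T (node2 r e D E)

-- Read bottom-up, every logical rule propagates cyclicity from a premise to
-- its conclusion, so acyclicity of the root is inherited by every sequent
-- above it. For all rules except □R the relational atoms in the antecedent of
-- a premise are among those of the conclusion, and cycles are monotone in the
-- set of edges. The rule □R adds the edge x → y for a fresh label y; since y
-- has no outgoing edge, no cycle can pass through it.
module Submission where

open import Defs
open import Data.List using (List; _∷_)
open import Data.List.Relation.Unary.Any using (here; there)
open import Data.Product using (∃-syntax; _×_; _,_; proj₁; proj₂)
open import Data.Sum using (inj₁; inj₂)
open import Data.Empty using (⊥-elim)
open import Data.List.Relation.Binary.BagAndSetEquality using (_∼[_]_; set)
open import Function using (_∘_; id)
open import Function.Bundles using (Equivalence)
open import Relation.Nullary using (¬_)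
open import Relation.Binary.Core using (Rel; _⇒_)
open import Relation.Binary.PropositionalEquality using (_≢_; refl)
open import Relation.Binary.Construct.Closure.Transitive using (TransClosure; [_]; _∷_)

TransClosure-map : ∀ {a ℓ₁ ℓ₂} {A : Set a} {R : Rel A ℓ₁} {S : Rel A ℓ₂} →
                   R ⇒ S → TransClosure R ⇒ TransClosure S
TransClosure-map R⇒S [ r ]    = [ R⇒S r ]
TransClosure-map R⇒S (r ∷ rs) = R⇒S r ∷ TransClosure-map R⇒S rs

HasCycle : List Elem → Set
HasCycle Γ = ∃[ x ] TransClosure (Step Γ) x x

cyclic⇒hasCycle : ∀ {S} → Cyclic S → HasCycle (ante S)
cyclic⇒hasCycle (x , _ , cycle) = x , cycle

-- The occurrence condition of Cyclic comes for free: the first edge of a cycle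
-- mentions its start.
hasCycle⇒cyclic : ∀ {Γ Δ} → HasCycle Γ → Cyclic (Γ ⊢ Δ)
hasCycle⇒cyclic (x , cycle@([ b , x→ ]))   = x , (rel x b _ , x→ , inj₁ refl) , cycle
hasCycle⇒cyclic (x , cycle@((b , x→) ∷ _)) = x , (rel x b _ , x→ , inj₁ refl) , cycle

hasCycle-mono : ∀ {Γ Γ′} → Step Γ ⇒ Step Γ′ → HasCycle Γ → HasCycle Γ′
hasCycle-mono Γ⇒Γ′ (x , cycle) = x , TransClosure-map Γ⇒Γ′ cycle

Step-∷⁺ : ∀ {e Γ} → Step Γ ⇒ Step (e ∷ Γ)
Step-∷⁺ (b , e∈) = b , there e∈

Step-lab⁻ : ∀ {x φ Γ} → Step (lab x φ ∷ Γ) ⇒ Step Γ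
Step-lab⁻ (b , there e∈) = b , e∈

Step-resp-set : ∀ {Γ Γ′} → Γ ∼[ set ] Γ′ → Step Γ ⇒ Step Γ′
Step-resp-set Γ≈Γ′ (b , e∈) = b , Equivalence.to Γ≈Γ′ e∈

module _ {x y : Label} {a : Atom} {Γ : List Elem}
         (y-sink : ∀ {w} → ¬ Step Γ y w) (x≢y : x ≢ y) where

  private
    Γ⁺ = rel x a y ∷ Γ

    y-sink⁺ : ∀ {w} → ¬ Step Γ⁺ y w
    y-sink⁺ (_ , here refl)  = x≢y refl
    y-sink⁺ (b , there y→w) = y-sink (b , y→w)

    y-sink⁺* : ∀ {w} → ¬ TransClosure (Step Γ⁺) y w
    y-sink⁺* [ y→w ]   = y-sink⁺ y→w
    y-sink⁺* (y→w ∷ _) = y-sink⁺ y→w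

    step-avoiding : ∀ {u v} → Step Γ⁺ u v → v ≢ y → Step Γ u v
    step-avoiding (_ , here refl)  v≢y = ⊥-elim (v≢y refl)
    step-avoiding (b , there u→v) _   = b , u→v

    -- Only the last edge of a path can end in the sink y.
    path-avoiding : ∀ {u v} → TransClosure (Step Γ⁺) u v → v ≢ y →
                    TransClosure (Step Γ) u v
    path-avoiding [ u→v ]        v≢y = [ step-avoiding u→v v≢y ]
    path-avoiding (u→w ∷ w→⁺v) v≢y =
      step-avoiding u→w (λ { refl → y-sink⁺* w→⁺v }) ∷ path-avoiding w→⁺v v≢y

  hasCycle-sink⁻ : HasCycle Γ⁺ → HasCycle Γ
  hasCycle-sink⁻ (u , cycle) = u , path-avoiding cycle (λ { refl → y-sink⁺* cycle })

fresh⇒sink : ∀ {Γ Δ x y φ w} → ¬ OccursInSeq y (Γ ⊢ lab x φ ∷ Δ) → ¬ Step Γ y w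
fresh⇒sink y∉ (b , y→w) = y∉ (inj₁ (rel _ b _ , y→w , inj₁ refl))

fresh⇒≢ : ∀ {Γ Δ x y φ} → ¬ OccursInSeq y (Γ ⊢ lab x φ ∷ Δ) → x ≢ y
fresh⇒≢ y∉ refl = y∉ (inj₂ (lab _ _ , here refl , refl))

Rule1-hasCycle : ∀ {P C} → Rule1 P C → HasCycle (ante P) → HasCycle (ante C)
Rule1-hasCycle ∧L      = hasCycle-mono (Step-∷⁺ ∘ Step-lab⁻ ∘ Step-lab⁻)
Rule1-hasCycle ∨R      = id
Rule1-hasCycle →R      = hasCycle-mono Step-lab⁻
Rule1-hasCycle □L      = hasCycle-mono (Step-∷⁺ ∘ Step-∷⁺ ∘ Step-lab⁻)
Rule1-hasCycle (□R y∉) = hasCycle-sink⁻ (fresh⇒sink y∉) (fresh⇒≢ y∉)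
Rule1-hasCycle ⨾L      = hasCycle-mono (Step-∷⁺ ∘ Step-lab⁻)
Rule1-hasCycle ⨾R      = id
Rule1-hasCycle ∪L      = hasCycle-mono (Step-∷⁺ ∘ Step-lab⁻ ∘ Step-lab⁻)
Rule1-hasCycle ?R      = hasCycle-mono Step-lab⁻
Rule1-hasCycle *L      = hasCycle-mono (Step-∷⁺ ∘ Step-lab⁻ ∘ Step-lab⁻)

Rule2-Step : ∀ {P Q C} → Rule2 P Q C →
             (Step (ante P) ⇒ Step (ante C)) × (Step (ante Q) ⇒ Step (ante C))
Rule2-Step ∧R = id , id
Rule2-Step ∨L = Step-∷⁺ ∘ Step-lab⁻ , Step-∷⁺ ∘ Step-lab⁻
Rule2-Step →L = Step-∷⁺ , Step-∷⁺ ∘ Step-lab⁻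
Rule2-Step ∪R = id , id
Rule2-Step ?L = Step-∷⁺ , Step-∷⁺ ∘ Step-lab⁻
Rule2-Step *R = id , id

hasCycle⇒cyclic-≅ : ∀ {C S} → C ≅ S → HasCycle (ante C) → Cyclic S
hasCycle⇒cyclic-≅ {S = S} (ante≈ , _) =
  hasCycle⇒cyclic {Δ = succ S} ∘ hasCycle-mono (Step-resp-set ante≈)

Rule1-cyclic : ∀ {P C S} → Rule1 P C → C ≅ S → Cyclic P → Cyclic S
Rule1-cyclic {P} {C} {S} r C≅S =
  hasCycle⇒cyclic-≅ {C} {S} C≅S ∘ Rule1-hasCycle r ∘ cyclic⇒hasCycle {P}

Rule2-cyclicˡ : ∀ {P Q C S} → Rule2 P Q C → C ≅ S → Cyclic P → Cyclic S
Rule2-cyclicˡ {P} {C = C} {S} r C≅S =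
  hasCycle⇒cyclic-≅ {C} {S} C≅S ∘ hasCycle-mono (proj₁ (Rule2-Step r)) ∘ cyclic⇒hasCycle {P}

Rule2-cyclicʳ : ∀ {P Q C S} → Rule2 P Q C → C ≅ S → Cyclic Q → Cyclic S
Rule2-cyclicʳ {Q = Q} {C} {S} r C≅S =
  hasCycle⇒cyclic-≅ {C} {S} C≅S ∘ hasCycle-mono (proj₂ (Rule2-Step r)) ∘ cyclic⇒hasCycle {Q}

proposition2 : ∀ {S} (D : Deriv S) → Acyclic S → ∀ T → AppearsIn T D → Acyclic T
proposition2 D acyclic T (root .D) = acyclic
proposition2 (node1 r C≅S D) acyclic T (in1 T∈D) =
  proposition2 D (acyclic ∘ Rule1-cyclic r C≅S) T T∈D
proposition2 (node2 r C≅S D E) acyclic T (in2ˡ T∈D) =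
  proposition2 D (acyclic ∘ Rule2-cyclicˡ r C≅S) T T∈D
proposition2 (node2 r C≅S D E) acyclic T (in2ʳ T∈E) =
  proposition2 E (acyclic ∘ Rule2-cyclicʳ r C≅S) T T∈E
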